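{- Let $T$ be an order tree and $G$ a uniform $T$-graph. Let $\varepsilon$ and $\varepsilon_n$ ($n\in\mathbb N$) be ends of $G$, and let $\varrho=\sigma(\varepsilon)$, $\varrho_n=\sigma(\varepsilon_n)$ be the corresponding high-rays. Let $A=\{n\in\mathbb N : \varrho\subsetneq\varrho_n\}$ and $B=\mathbb N\setminus A$. (i) $\varepsilon_n\to\varepsilon$ in $\Omega(G)$ as $n\to\infty$ with $n\in A$ if and only if $A$ is infinite and for every top $t$ of $\varrho$ there are only finitely many $n\in A$ with $t\in\varrho_n$. (ii) $\varepsilon_n\to\varepsilon$ in $\Omega(G)$ as $n\to\infty$ with $n\in B$ if and only if $B$ is infinite and for every successor $t\in\varrho$ there are only finitely many $n\in B$ with $\varrho\cap\varrho_n\subset\mathring{\lceil t\rceil}$.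
   Context: Ends: a ray is a one-way infinite path; two rays are equivalent if for every finite $X\subset V(G)$ they have tails in the same component of $G-X$; the classes are the ends, forming $\Omega(G)$ with the topology whose basic open sets are $\{\varepsilon : C(X,\varepsilon)=C\}$ for finite $X$ and components $C$ of $G-X$, where $C(X,\varepsilon)$ is the component of $G-X$ containing tails of all rays of $\varepsilon$. For a vertex set $M$, $\partial M$ is the set of ends $\varepsilon$ with $C(X,\varepsilon)\cap M\neq\emptyset$ for all finite $X$. An order tree is a poset $(T,\le)$ with a unique minimal element in which every $\lceil t\rceil=\{t'\le t\}$ is well-ordered; $\mathring{\lceil t\rceil}=\lceil t\rceil\setminus\{t\}$, $\lfloor t\rfloor=\{t'\ge t\}$. $t'$ is a successor of $t$ if $t<t'$ with nothing strictly between; a point is a limit if it is not a successor of any point. A high-ray is a down-closed chain whose order type has cofinality $\omega$; a top of a down-closed chain $\mathcal C$ is a limit $t\notin\mathcal C$ with $\mathring{\lceil t\rceil}=\mathcal C$. A graph $G$ is a $T$-graph if $V(G)=T$, endvertices of edges are comparable, and for each $t$ its neighbours below $t$ are cofinal in $\mathring{\lceil t\rceil}$. It is uniform if for every limit $t$ there is a finite $S_t\subset\mathring{\lceil t\rceil}$ such that every $t'>t$ has all its neighbours $s$ with $s<t$ in $S_t$. For an end $\varepsilon$, $\sigma(\varepsilon)=\{t\in T:\varepsilon\in\partial\lfloor t\rfloor\setminus\partial(T\setminus\lfloor t\rfloor)\}$; for uniform $T$-graphs this is a high-ray of $T$ and $\sigma$ is a bijection from the ends onto the high-rays. -}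

module Defs where

open import Data.Nat as ℕ using (ℕ; suc)
open import Data.Product using (Σ; ∃; ∃-syntax; _×_; _,_)
open import Data.Sum using (_⊎_)
open import Data.List using (List)
open import Data.List.Membership.Propositional using (_∈_; _∉_)
open import Relation.Nullary using (¬_)
open import Relation.Binary.PropositionalEquality using (_≡_; _≢_)

record OrderTree : Set₁ where
  field
    Carrier  : Set
    _≤_      : Carrier → Carrier → Set
    ≤-refl   : ∀ {x} → x ≤ x
    ≤-antisym : ∀ {x y} → x ≤ y → y ≤ x → x ≡ y
    ≤-trans  : ∀ {x y z} → x ≤ y → y ≤ z → x ≤ z
    root           : Carrier
    root-minimal   : ∀ t → t ≤ root → t ≡ root
    minimal-unique : ∀ m → (∀ t → t ≤ m → t ≡ m) → m ≡ root
    down-chain : ∀ t x y → x ≤ t → y ≤ t → (x ≤ y) ⊎ (y ≤ x)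
    down-wf    : ∀ t (S : Carrier → Set) →
                 (∃ λ s → s ≤ t × S s) →
                 ∃ λ m → m ≤ t × S m × (∀ s → s ≤ t → S s → m ≤ s)

module TreeNotions (T : OrderTree) where
  open OrderTree T

  _<_ : Carrier → Carrier → Set
  x < y = x ≤ y × x ≢ y

  -- ⌈t⌉ (open): {t' : t' < t};   ⌊t⌋ = {t' : t ≤ t'}
  DownOpen : Carrier → Carrier → Set
  DownOpen t t' = t' < t

  Up : Carrier → Carrier → Set
  Up t t' = t ≤ t'

  SuccessorOf : Carrier → Carrier → Set
  SuccessorOf t t' = t < t' × ¬ (∃ λ s → t < s × s < t')

  IsSuccessor : Carrier → Set
  IsSuccessor t' = ∃ λ t → SuccessorOf t t'

  IsLimit : Carrier → Set
  IsLimit t' = ¬ IsSuccessor t'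

  DownClosedChain : (Carrier → Set) → Set
  DownClosedChain C =
    (∀ x y → C y → x ≤ y → C x) × (∀ x y → C x → C y → (x ≤ y) ⊎ (y ≤ x))

  -- a down-closed chain whose order type has cofinality ω:
  -- it has a strictly increasing cofinal ω-sequence
  HighRay : (Carrier → Set) → Set
  HighRay C = DownClosedChain C ×
    (∃ λ (f : ℕ → Carrier) → (∀ n → C (f n)) × (∀ n → f n < f (suc n))
                           × (∀ x → C x → ∃ λ n → x ≤ f n))

  Top : (Carrier → Set) → Carrier → Set
  Top C t = IsLimit t × ¬ C t × (∀ x → (DownOpen t x → C x) × (C x → DownOpen t x))

record TGraph (T : OrderTree) : Set₁ where
  open OrderTree T
  open TreeNotions T
  field
    _~_        : Carrier → Carrier → Set
    ~-sym      : ∀ {x y} → x ~ y → y ~ x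
    ~-irrefl   : ∀ {x} → ¬ (x ~ x)
    comparable : ∀ {x y} → x ~ y → (x ≤ y) ⊎ (y ≤ x)
    cofinal    : ∀ t x → x < t → ∃ λ s → s ~ t × x ≤ s × s < t

module GraphNotions (T : OrderTree) (G : TGraph T) where
  open OrderTree T
  open TreeNotions T
  open TGraph G

  Uniform : Set
  Uniform = ∀ t → IsLimit t →
    ∃ λ (S : List Carrier) → (∀ s → s ∈ S → s < t) ×
      (∀ t' → t < t' → ∀ s → s ~ t' → s < t → s ∈ S)

  record Ray : Set where
    field
      vtx : ℕ → Carrier
      inj : ∀ m n → vtx m ≡ vtx n → m ≡ n
      adj : ∀ n → vtx n ~ vtx (suc n)
  open Ray public

  data Reach (X : List Carrier) : Carrier → Carrier → Set where
    here : ∀ {u} → u ∉ X → Reach X u u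
    step : ∀ {u v w} → Reach X u v → v ~ w → w ∉ X → Reach X u w

  -- v ∈ C(X, R): v lies in the component of G - X containing a tail of R
  InComp : List Carrier → Ray → Carrier → Set
  InComp X R v = ∃ λ k → ∀ m → k ℕ.≤ m → Reach X v (vtx R m)

  -- equivalence of rays (equality of ends); ends are represented by rays
  SameEnd : Ray → Ray → Set
  SameEnd R R' = ∀ (X : List Carrier) → ∃ λ v → InComp X R v × InComp X R' v

  IsComponent : List Carrier → (Carrier → Set) → Set
  IsComponent X C = ∃ λ u → u ∉ X × (∀ v → (C v → Reach X u v) × (Reach X u v → C v))

  -- basic open set {ε : C(X, ε) = C}
  BasicOpen : List Carrier → (Carrier → Set) → Ray → Set
  BasicOpen X C R = ∀ v → (InComp X R v → C v) × (C v → InComp X R v)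

  Boundary : (Carrier → Set) → Ray → Set
  Boundary M R = ∀ (X : List Carrier) → ∃ λ v → M v × InComp X R v

  σ : Ray → Carrier → Set
  σ R t = Boundary (Up t) R × ¬ Boundary (λ x → ¬ Up t x) R

  Infinite : (ℕ → Set) → Set
  Infinite A = ∀ N → ∃ λ n → N ℕ.≤ n × A n

  FinitelyMany : (ℕ → Set) → Set
  FinitelyMany P = ∃ λ N → ∀ n → N ℕ.≤ n → ¬ P n

  ConvergesAlong : (ℕ → Set) → (ℕ → Ray) → Ray → Set₁
  ConvergesAlong A εs ε = Infinite A ×
    (∀ (X : List Carrier) (C : Carrier → Set) → IsComponent X C → BasicOpen X C ε →
       ∃ λ N → ∀ n → N ℕ.≤ n → A n → BasicOpen X C (εs n))

  ProperSubset : (Carrier → Set) → (Carrier → Set) → Set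
  ProperSubset P Q = (∀ t → P t → Q t) × (∃ λ t → Q t × ¬ P t)

{-# OPTIONS --safe #-}
module Submission where

-- The key fact is a description of basic neighbourhoods of ε in terms of ϱ = σ(ε): for every
-- finite X there are r ∈ ϱ and finitely many tops t₁, …, tₖ of ϱ such that every end whose
-- high-ray contains r but none of the tᵢ lies in C(X, ε). It is built up vertex by vertex: a
-- vertex x ∈ X lying above all of ϱ sits above a top t of ϱ, and uniformity makes the finite
-- set {t} ∪ S_t separate ⌊t⌋ from the rest of G, so an end avoiding t cannot reach x; any
-- other x is avoided by raising r above it. Between r and the high-ray of such an end, the
-- cofinality of lower neighbours gives a path in G − X. Conversely, the components of
-- G − ({t} ∪ S_t) for a top t, and the components C(Y, ε) ⊆ ⌊t⌋ for t ∈ ϱ, are basic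
-- neighbourhoods of ε witnessing the necessity of the two finiteness conditions.

open import Defs
open import Level using (0ℓ)
open import Data.Nat using (ℕ)
open import Data.Product using (_×_)
open import Relation.Nullary using (¬_)
open import Function.Bundles using (_⇔_)
open import Axiom.ExcludedMiddle using (ExcludedMiddle)

open import Axiom.DoubleNegationElimination using (em⇒dne)
open import Data.Empty using (⊥; ⊥-elim)
open import Data.List using (List; []; _∷_; _++_)
open import Data.List.Membership.Propositional using (_∈_; _∉_)
open import Data.List.Relation.Binary.Subset.Propositional using (_⊆_)
open import Data.List.Relation.Binary.Subset.Propositional.Properties
  using (⊆-trans; xs⊆x∷xs; ∷⁺ʳ; xs⊆xs++ys; xs⊆ys++xs)
open import Data.List.Relation.Unary.Any using (here; there)
open import Data.Nat.Base as Nat using (zero; suc; _+_; _∸_; _⊔_)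
import Data.Nat.Properties as ℕ
open import Data.Product using (∃; _,_; proj₁; proj₂)
open import Data.Sum using (_⊎_; inj₁; inj₂)
open import Data.Unit using (⊤; tt)
open import Function using (id)
open import Function.Bundles using (mk⇔)
open import Relation.Binary.PropositionalEquality using (_≡_; refl; sym; trans; subst)
open import Relation.Nullary using (yes; no)

module Classical (em : ExcludedMiddle 0ℓ) where

  dne : {P : Set} → ¬ ¬ P → P
  dne = em⇒dne em

  ¬∀⇒∃¬ : {A : Set} {P : A → Set} → ¬ (∀ a → P a) → ∃ λ a → ¬ P a
  ¬∀⇒∃¬ ¬∀ = dne λ ¬∃ → ¬∀ λ a → dne λ ¬Pa → ¬∃ (a , ¬Pa)

  ¬→⇒×¬ : {P Q : Set} → ¬ (P → Q) → P × ¬ Q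
  ¬→⇒×¬ ¬P→Q = dne (λ ¬P → ¬P→Q (λ p → ⊥-elim (¬P p))) , λ q → ¬P→Q (λ _ → q)

module OrderTreeProperties (T : OrderTree) where
  open OrderTree T
  open TreeNotions T

  <-irrefl : ∀ {x} → ¬ (x < x)
  <-irrefl (_ , x≢x) = x≢x refl

  <⇒≱ : ∀ {x y} → x < y → ¬ (y ≤ x)
  <⇒≱ (x≤y , x≢y) y≤x = x≢y (≤-antisym x≤y y≤x)

  <-≤-trans : ∀ {x y z} → x < y → y ≤ z → x < z
  <-≤-trans (x≤y , x≢y) y≤z = ≤-trans x≤y y≤z , λ { refl → x≢y (≤-antisym x≤y y≤z) }

  root-least : ∀ t → root ≤ t
  root-least t with down-wf t (λ _ → ⊤) (t , ≤-refl , tt)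
  ... | m , m≤t , _ , least = subst (_≤ t) (minimal-unique m m-minimal) m≤t
    where
    m-minimal : ∀ s → s ≤ m → s ≡ m
    m-minimal s s≤m = ≤-antisym s≤m (least s (≤-trans s≤m m≤t) tt)

module Connectivity (T : OrderTree) (G : TGraph T) where
  open OrderTree T
  open TGraph G
  open GraphNotions T G

  private
    variable
      X Z : List Carrier
      u v w : Carrier
      C : Carrier → Set

  reach-source∉ : Reach X u v → u ∉ X
  reach-source∉ (here u∉X) = u∉X
  reach-source∉ (step p _ _) = reach-source∉ p

  reach-target∉ : Reach X u v → v ∉ X
  reach-target∉ (here v∉X) = v∉X
  reach-target∉ (step _ _ v∉X) = v∉X

  reach-trans : Reach X u v → Reach X v w → Reach X u w
  reach-trans p (here _) = p
  reach-trans p (step q e w∉X) = step (reach-trans p q) e w∉X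

  reach-sym : Reach X u v → Reach X v u
  reach-sym (here u∉X) = here u∉X
  reach-sym (step q e w∉X) = reach-trans (step (here w∉X) (~-sym e) (reach-target∉ q)) (reach-sym q)

  reach-weaken : X ⊆ Z → Reach Z u v → Reach X u v
  reach-weaken X⊆Z (here u∉Z) = here (λ u∈X → u∉Z (X⊆Z u∈X))
  reach-weaken X⊆Z (step p e w∉Z) = step (reach-weaken X⊆Z p) e (λ w∈X → w∉Z (X⊆Z w∈X))

  inComp-weaken : ∀ R → X ⊆ Z → InComp Z R v → InComp X R v
  inComp-weaken R X⊆Z (k , tail) = k , λ m k≤m → reach-weaken X⊆Z (tail m k≤m)

  inComp-connected : ∀ R → InComp X R v → InComp X R w → Reach X v w
  inComp-connected R (k , tail) (k' , tail') =
    reach-trans (tail (k ⊔ k') (ℕ.m≤m⊔n k k')) (reach-sym (tail' (k ⊔ k') (ℕ.m≤n⊔m k k')))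

  inComp-closed : ∀ R → InComp X R v → Reach X v w → InComp X R w
  inComp-closed R (k , tail) p = k , λ m k≤m → reach-trans (reach-sym p) (tail m k≤m)

  inComp-∉ : ∀ R → InComp X R v → v ∉ X
  inComp-∉ R (k , tail) = reach-source∉ (tail k ℕ.≤-refl)

  basicOpen-transfer : ∀ R R' → InComp X R w → InComp X R' w → BasicOpen X C R → BasicOpen X C R'
  basicOpen-transfer R R' w∈R w∈R' open-R v =
    (λ v∈R' → proj₁ (open-R v) (inComp-closed R w∈R (inComp-connected R' w∈R' v∈R'))) ,
    (λ v∈C → inComp-closed R' w∈R' (inComp-connected R w∈R (proj₂ (open-R v) v∈C)))

module EndProperties (em : ExcludedMiddle 0ℓ) (T : OrderTree) (G : TGraph T) where
  open OrderTree T
  open TreeNotions T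
  open TGraph G
  open GraphNotions T G
  open Classical em
  open OrderTreeProperties T
  open Connectivity T G

  tail-avoids : ∀ (R : Ray) W → ∃ λ k → ∀ m → k Nat.≤ m → vtx R m ∉ W
  tail-avoids R [] = 0 , λ _ _ ()
  tail-avoids R (x ∷ W) with tail-avoids R W | em {∃ λ i → vtx R i ≡ x}
  ... | k , avoids | yes (i , Ri≡x) = k ⊔ suc i , λ
        { m k⊔i<m (here Rm≡x) → ℕ.<-irrefl (sym (inj R m i (trans Rm≡x (sym Ri≡x))))
                                             (ℕ.≤-trans (ℕ.m≤n⊔m k (suc i)) k⊔i<m)
        ; m k⊔i<m (there Rm∈W) → avoids m (ℕ.≤-trans (ℕ.m≤m⊔n k (suc i)) k⊔i<m) Rm∈W }
  ... | k , avoids | no x∉R = k , λ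
        { m _ (here Rm≡x) → x∉R (m , Rm≡x)
        ; m k≤m (there Rm∈W) → avoids m k≤m Rm∈W }

  reach-along : ∀ (R : Ray) W k → (∀ m → k Nat.≤ m → vtx R m ∉ W) →
                ∀ d → Reach W (vtx R k) (vtx R (d + k))
  reach-along R W k avoids zero = here (avoids k ℕ.≤-refl)
  reach-along R W k avoids (suc d) =
    step (reach-along R W k avoids d) (adj R (d + k)) (avoids (suc d + k) (ℕ.m≤n+m k (suc d)))

  inComp-nonempty : ∀ (R : Ray) W → ∃ (InComp W R)
  inComp-nonempty R W with tail-avoids R W
  ... | k , avoids = vtx R k , k , λ m k≤m →
    subst (λ j → Reach W (vtx R k) (vtx R j)) (ℕ.m∸n+n≡m k≤m) (reach-along R W k avoids (m ∸ k))

  inComp-isComponent : ∀ X R → IsComponent X (InComp X R)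
  inComp-isComponent X R with inComp-nonempty R X
  ... | u , u∈ = u , inComp-∉ R u∈ , λ v → inComp-connected R u∈ , inComp-closed R u∈

  ComponentAbove : Ray → Carrier → Set
  ComponentAbove R t = ∃ λ Y → ∀ v → InComp Y R v → t ≤ v

  componentAbove⇒σ : ∀ R {t} → ComponentAbove R t → σ R t
  componentAbove⇒σ R (Y , above) = meets , avoids
    where
    meets : Boundary (Up _) R
    meets W with inComp-nonempty R (W ++ Y)
    ... | v , v∈ = v , above v (inComp-weaken R (xs⊆ys++xs Y W) v∈) , inComp-weaken R (xs⊆xs++ys W Y) v∈
    avoids : ¬ Boundary (λ x → ¬ Up _ x) R
    avoids outside with outside Y
    ... | v , t≰v , v∈ = t≰v (above v v∈)

  σ⇒componentAbove : ∀ R {t} → σ R t → ComponentAbove R t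
  σ⇒componentAbove R (_ , ¬outside) =
    dne λ ¬above → ¬outside λ Y → dne λ ¬witness →
      ¬above (Y , λ v v∈ → dne λ t≰v → ¬witness (v , t≰v , v∈))

  σ-downClosed : ∀ R {x y} → x ≤ y → σ R y → σ R x
  σ-downClosed R x≤y y∈σ with σ⇒componentAbove R y∈σ
  ... | Y , above = componentAbove⇒σ R (Y , λ v v∈ → ≤-trans x≤y (above v v∈))

  σ-total : ∀ R {t t'} → σ R t → σ R t' → (t ≤ t') ⊎ (t' ≤ t)
  σ-total R {t} {t'} t∈σ t'∈σ with σ⇒componentAbove R t∈σ | σ⇒componentAbove R t'∈σ
  ... | Y , above | Y' , above' with inComp-nonempty R (Y ++ Y')
  ... | v , v∈ = down-chain v t t' (above v (inComp-weaken R (xs⊆xs++ys Y Y') v∈))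
                                   (above' v (inComp-weaken R (xs⊆ys++xs Y' Y) v∈))

  σ-root : ∀ R → σ R root
  σ-root R = componentAbove⇒σ R ([] , λ v _ → root-least v)

  -- The least vertex t' above t on the way to a tail of R stays below everything reachable
  -- in G − (t ∷ Y): an edge leading down past t' would end strictly between t and t'.
  σ-noMaximum : ∀ R {t} → σ R t → ∃ λ t' → t < t' × σ R t'
  σ-noMaximum R {t} t∈σ with σ⇒componentAbove R t∈σ
  ... | Y , above with inComp-nonempty R (t ∷ Y)
  ... | v₀ , v₀∈ with down-wf v₀ (t <_) (v₀ , ≤-refl , t<v₀)
    where
    t<v₀ : t < v₀
    t<v₀ = above v₀ (inComp-weaken R (xs⊆x∷xs Y t) v₀∈) , λ t≡v₀ → inComp-∉ R v₀∈ (here (sym t≡v₀))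
  ... | t' , t'≤v₀ , t<t' , least =
    t' , t<t' , componentAbove⇒σ R ((t ∷ Y) , λ w w∈ → stays-above (inComp-connected R v₀∈ w∈))
    where
    stays-above : ∀ {w} → Reach (t ∷ Y) v₀ w → t' ≤ w
    stays-above (here _) = t'≤v₀
    stays-above (step {v = b} {w = w} p b~w w∉) with comparable b~w
    ... | inj₁ b≤w = ≤-trans (stays-above p) b≤w
    ... | inj₂ w≤b with down-chain b t' w (stays-above p) w≤b
    ...   | inj₁ t'≤w = t'≤w
    ...   | inj₂ w≤t' = least w (≤-trans w≤t' t'≤v₀) (t≤w , λ t≡w → w∉ (here (sym t≡w)))
      where
      t≤w : t ≤ w
      t≤w = above w (inComp-weaken R (xs⊆x∷xs Y t) (inComp-closed R v₀∈ (step p b~w w∉)))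

  reach-interval : ∀ {X} r v → r ≤ v → (∀ u → r ≤ u → u ≤ v → u ∉ X) → Reach X r v
  reach-interval {X} r v r≤v avoids = dne unreachable
    where
    unreachable : ¬ Reach X r v → ⊥
    unreachable r↛v with down-wf v (λ u → r ≤ u × ¬ Reach X r u) (v , ≤-refl , r≤v , r↛v)
    ... | m , m≤v , (r≤m , r↛m) , least with em {r ≡ m}
    ...   | yes refl = r↛m (here (avoids r ≤-refl r≤v))
    ...   | no r≢m with cofinal m r (r≤m , r≢m)
    ...     | s , s~m , r≤s , s<m = r↛m (step r→s s~m (avoids m r≤m m≤v))
      where
      r→s : Reach X r s
      r→s = dne λ r↛s → <⇒≱ s<m (least s (≤-trans (proj₁ s<m) m≤v) (r≤s , r↛s))

  Separates : List Carrier → Carrier → Set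
  Separates Z t = ∀ R {v} → InComp Z R v → t ≤ v → σ R t

  separates-⊆ : ∀ {Z Z' t} → Z ⊆ Z' → Separates Z t → Separates Z' t
  separates-⊆ Z⊆Z' sep R v∈ = sep R (inComp-weaken R Z⊆Z' v∈)

  LowerEndsIn : List Carrier → Carrier → Set
  LowerEndsIn S t = ∀ t' → t < t' → ∀ s → s ~ t' → s < t → s ∈ S

  up-reach-closed : ∀ {S t} → LowerEndsIn S t → ∀ {a b} → Reach (t ∷ S) a b → t ≤ a → t ≤ b
  up-reach-closed lower (here _) t≤a = t≤a
  up-reach-closed {S} {t} lower (step {v = b} {w = w} p b~w w∉) t≤a with comparable b~w
  ... | inj₁ b≤w = ≤-trans (up-reach-closed lower p t≤a) b≤w
  ... | inj₂ w≤b with down-chain b t w (up-reach-closed lower p t≤a) w≤b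
  ...   | inj₁ t≤w = t≤w
  ...   | inj₂ w≤t = ⊥-elim (w∉ (there (lower b t<b w (~-sym b~w) w<t)))
    where
    t<b : t < b
    t<b = up-reach-closed lower p t≤a , λ t≡b → reach-target∉ p (here (sym t≡b))
    w<t : w < t
    w<t = w≤t , λ w≡t → w∉ (here w≡t)

  limit-separates : ∀ {S t} → LowerEndsIn S t → Separates (t ∷ S) t
  limit-separates {S} {t} lower R v∈ t≤v =
    componentAbove⇒σ R ((t ∷ S) , λ w w∈ → up-reach-closed lower (inComp-connected R v∈ w∈) t≤v)

module UniformGraph (em : ExcludedMiddle 0ℓ) (T : OrderTree) (G : TGraph T) (U : GraphNotions.Uniform T G)
                    (ε : GraphNotions.Ray T G) where
  open OrderTree T
  open TreeNotions T
  open GraphNotions T G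
  open Classical em
  open OrderTreeProperties T
  open Connectivity T G
  open EndProperties em T G

  ϱ : Carrier → Set
  ϱ = σ ε

  ϱ-upperBound : ∀ {a b} → ϱ a → ϱ b → ∃ λ c → ϱ c × a ≤ c × b ≤ c
  ϱ-upperBound {a} {b} a∈ϱ b∈ϱ with σ-total ε a∈ϱ b∈ϱ
  ... | inj₁ a≤b = b , b∈ϱ , a≤b , ≤-refl
  ... | inj₂ b≤a = a , a∈ϱ , ≤-refl , b≤a

  top-below : ∀ x → (∀ y → ϱ y → y < x) → ∃ λ m → Top ϱ m × m ≤ x
  top-below x ϱ<x with down-wf x (λ u → ¬ ϱ u) (x , ≤-refl , λ x∈ϱ → <-irrefl (ϱ<x x x∈ϱ))
  ... | m , m≤x , m∉ϱ , least = m , (m-limit , m∉ϱ , λ z → below z , above z) , m≤x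
    where
    below : ∀ z → z < m → ϱ z
    below z z<m = dne λ z∉ϱ → <⇒≱ z<m (least z (≤-trans (proj₁ z<m) m≤x) z∉ϱ)
    above : ∀ z → ϱ z → z < m
    above z z∈ϱ with down-chain x z m (proj₁ (ϱ<x z z∈ϱ)) m≤x
    ... | inj₁ z≤m = z≤m , λ z≡m → m∉ϱ (subst ϱ z≡m z∈ϱ)
    ... | inj₂ m≤z = ⊥-elim (m∉ϱ (σ-downClosed ε m≤z z∈ϱ))
    m-limit : IsLimit m
    m-limit (p , p<m , nothing-between) with σ-noMaximum ε (below p p<m)
    ... | q , p<q , q∈ϱ = nothing-between (q , p<q , above q q∈ϱ)

  successor-above : ∀ {r} → ϱ r → ∃ λ t → ϱ t × r ≤ t × IsSuccessor t
  successor-above {r} r∈ϱ with σ-noMaximum ε r∈ϱ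
  ... | q , r<q , q∈ϱ with down-wf q (r <_) (q , ≤-refl , r<q)
  ... | m , m≤q , r<m , least =
    m , σ-downClosed ε m≤q q∈ϱ , proj₁ r<m ,
    (r , r<m , λ { (s , r<s , s<m) → <⇒≱ s<m (least s (≤-trans (proj₁ s<m) m≤q) r<s) })

  record Cover (X : List Carrier) : Set where
    field
      base          : Carrier
      base∈ϱ        : ϱ base
      tops          : List Carrier
      tops-top      : ∀ {t} → t ∈ tops → Top ϱ t
      cut           : List Carrier
      X⊆cut         : X ⊆ cut
      cut-separates : ∀ {t} → t ∈ tops → Separates cut t
      X-aboveTop    : ∀ {x} → x ∈ X → base ≤ x → ∃ λ t → t ∈ tops × t ≤ x

  open Cover

  cover-addTop : ∀ {X} x → Cover X → (∀ y → ϱ y → y < x) → Cover (x ∷ X)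
  cover-addTop x K ϱ<x with top-below x ϱ<x
  ... | m , m-top , m≤x with U m (proj₁ m-top)
  ... | S , _ , lower = record
    { base = base K ; base∈ϱ = base∈ϱ K ; tops = m ∷ tops K
    ; tops-top = λ { (here refl) → m-top ; (there t∈) → tops-top K t∈ }
    ; cut = x ∷ (m ∷ S) ++ cut K
    ; X⊆cut = ∷⁺ʳ x (⊆-trans (X⊆cut K) old⊆new)
    ; cut-separates = λ
        { (here refl) → separates-⊆ m∷S⊆new (limit-separates lower)
        ; (there t∈) → separates-⊆ (⊆-trans old⊆new (xs⊆x∷xs _ x)) (cut-separates K t∈) }
    ; X-aboveTop = λ
        { (here refl) _ → m , here refl , m≤x
        ; (there x'∈) base≤x' → let (t , t∈ , t≤x') = X-aboveTop K x'∈ base≤x' in t , there t∈ , t≤x' } }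
    where
    old⊆new : cut K ⊆ (m ∷ S) ++ cut K
    old⊆new = xs⊆ys++xs (cut K) (m ∷ S)
    m∷S⊆new : m ∷ S ⊆ x ∷ (m ∷ S) ++ cut K
    m∷S⊆new = ⊆-trans (xs⊆xs++ys (m ∷ S) (cut K)) (xs⊆x∷xs _ x)

  cover-raiseBase : ∀ {X} x → Cover X → ¬ (∀ y → ϱ y → y < x) → Cover (x ∷ X)
  cover-raiseBase x K ¬ϱ<x with ¬∀⇒∃¬ ¬ϱ<x
  ... | b , ¬[b∈ϱ⇒b<x] with ¬→⇒×¬ ¬[b∈ϱ⇒b<x]
  ... | b∈ϱ , b≮x with σ-noMaximum ε b∈ϱ
  ... | b' , b<b' , b'∈ϱ with ϱ-upperBound (base∈ϱ K) b'∈ϱ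
  ... | c , c∈ϱ , base≤c , b'≤c = record
    { base = c ; base∈ϱ = c∈ϱ ; tops = tops K ; tops-top = tops-top K
    ; cut = x ∷ cut K
    ; X⊆cut = ∷⁺ʳ x (X⊆cut K)
    ; cut-separates = λ t∈ → separates-⊆ (xs⊆x∷xs _ x) (cut-separates K t∈)
    ; X-aboveTop = λ
        { (here refl) c≤x → ⊥-elim (b≮x (<-≤-trans b<b' (≤-trans b'≤c c≤x)))
        ; (there x'∈) c≤x' → X-aboveTop K x'∈ (≤-trans base≤c c≤x') } }

  cover : ∀ X → Cover X
  cover [] = record
    { base = root ; base∈ϱ = σ-root ε ; tops = [] ; tops-top = λ ()
    ; cut = [] ; X⊆cut = λ () ; cut-separates = λ () ; X-aboveTop = λ () }
  cover (x ∷ X) with em {∀ y → ϱ y → y < x}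
  ... | yes ϱ<x  = cover-addTop x (cover X) ϱ<x
  ... | no ¬ϱ<x = cover-raiseBase x (cover X) ¬ϱ<x

  cover-inComp : ∀ {X} (K : Cover X) R → σ R (base K) → (∀ {t} → t ∈ tops K → ¬ σ R t) →
                 InComp X R (base K)
  cover-inComp K R base∈σ avoids-tops with proj₁ base∈σ (cut K)
  ... | v , base≤v , v∈ =
    inComp-closed R (inComp-weaken R (X⊆cut K) v∈) (reach-sym (reach-interval _ v base≤v outside-X))
    where
    outside-X : ∀ u → base K ≤ u → u ≤ v → u ∉ _
    outside-X u base≤u u≤v u∈X with X-aboveTop K u∈X base≤u
    ... | t , t∈ , t≤u = avoids-tops t∈ (cut-separates K t∈ R v∈ (≤-trans t≤u u≤v))

  basicOpen-near : ∀ {X C} (K : Cover X) R → BasicOpen X C ε →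
                   σ R (base K) → (∀ {t} → t ∈ tops K → ¬ σ R t) → BasicOpen X C R
  basicOpen-near K R ε-open base∈σ avoids-tops =
    basicOpen-transfer ε R (cover-inComp K ε (base∈ϱ K) (λ t∈ → proj₁ (proj₂ (tops-top K t∈))))
                           (cover-inComp K R base∈σ avoids-tops) ε-open

  finitelyMany-all : ∀ {I : Set} (P : I → ℕ → Set) (L : List I) →
                     (∀ {i} → i ∈ L → FinitelyMany (P i)) →
                     ∃ λ N → ∀ {i} → i ∈ L → ∀ n → N Nat.≤ n → ¬ P i n
  finitelyMany-all P [] _ = 0 , λ ()
  finitelyMany-all P (i ∷ L) finite
    with finite (here refl) | finitelyMany-all P L (λ j∈ → finite (there j∈))
  ... | M , beyond-M | N , beyond-N = M ⊔ N , λ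
      { (here refl) n M⊔N≤n → beyond-M n (ℕ.≤-trans (ℕ.m≤m⊔n M N) M⊔N≤n)
      ; (there j∈) n M⊔N≤n → beyond-N j∈ n (ℕ.≤-trans (ℕ.m≤n⊔m M N) M⊔N≤n) }

  eventually-inComp : ∀ P εs → ConvergesAlong P εs ε → ∀ X →
                      ∃ λ N → ∀ n → N Nat.≤ n → P n → ∀ v → InComp X (εs n) v → InComp X ε v
  eventually-inComp P εs (_ , converges) X
    with converges X (InComp X ε) (inComp-isComponent X ε) (λ _ → id , id)
  ... | N , near = N , λ n N≤n Pn v → proj₁ (near n N≤n Pn v)

  ¬below⇒above : ∀ R {t} → ϱ t → ¬ (∀ s → ϱ s → σ R s → DownOpen t s) → ∃ λ s → σ R s × t ≤ s
  ¬below⇒above R {t} t∈ϱ ¬below with ¬∀⇒∃¬ ¬below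
  ... | s , ¬[s∈ϱ⇒…] with ¬→⇒×¬ ¬[s∈ϱ⇒…]
  ... | s∈ϱ , ¬[s∈σ⇒…] with ¬→⇒×¬ ¬[s∈σ⇒…]
  ... | s∈σ , s≮t = s , s∈σ , t≤s
    where
    t≤s : t ≤ s
    t≤s with σ-total ε s∈ϱ t∈ϱ | em {s ≡ t}
    ... | inj₂ t≤s | _ = t≤s
    ... | inj₁ _   | yes refl = ≤-refl
    ... | inj₁ s≤t | no s≢t = ⊥-elim (s≮t (s≤t , s≢t))

  module Convergence (εs : ℕ → Ray) where

    A : ℕ → Set
    A n = ProperSubset ϱ (σ (εs n))

    B : ℕ → Set
    B n = ¬ A n

    TopsFinite : Set
    TopsFinite = ∀ t → Top ϱ t → FinitelyMany (λ n → A n × σ (εs n) t)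

    SuccessorsFinite : Set
    SuccessorsFinite = ∀ t → ϱ t → IsSuccessor t →
      FinitelyMany (λ n → B n × (∀ s → ϱ s → σ (εs n) s → DownOpen t s))

    top∈σ⇒A : ∀ {n t} → Top ϱ t → σ (εs n) t → A n
    top∈σ⇒A {n} (_ , t∉ϱ , ϱ≡⌈t⌉) t∈σ =
      (λ y y∈ϱ → σ-downClosed (εs n) (proj₁ (proj₂ (ϱ≡⌈t⌉ y) y∈ϱ)) t∈σ) , (_ , t∈σ , t∉ϱ)

    converges⇒tops-finite : ConvergesAlong A εs ε → TopsFinite
    converges⇒tops-finite converges t t-top with U t (proj₁ t-top)
    ... | S , _ , lower with eventually-inComp A εs converges (t ∷ S)
    ... | N , near = N , λ n N≤n (An , t∈σ) →
      let (v , t≤v , v∈) = proj₁ t∈σ (t ∷ S)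
      in proj₁ (proj₂ t-top) (limit-separates lower ε (near n N≤n An v v∈) t≤v)

    converges⇒successors-finite : ConvergesAlong B εs ε → SuccessorsFinite
    converges⇒successors-finite converges t t∈ϱ _ with σ⇒componentAbove ε t∈ϱ
    ... | Y , above with eventually-inComp B εs converges Y
    ... | N , near = N , λ n N≤n (Bn , ϱ∩σ<t) →
      <-irrefl (ϱ∩σ<t t t∈ϱ (componentAbove⇒σ (εs n) (Y , λ v v∈ → above v (near n N≤n Bn v v∈))))

    tops-finite⇒converges : Infinite A × TopsFinite → ConvergesAlong A εs ε
    tops-finite⇒converges (infinite , finite) = infinite , λ X C _ ε-open →
      let K = cover X
          (N , beyond) = finitelyMany-all _ (tops K) (λ t∈ → finite _ (tops-top K t∈))
      in N , λ n N≤n An →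
        basicOpen-near K (εs n) ε-open (proj₁ An _ (base∈ϱ K)) (λ t∈ t∈σ → beyond t∈ n N≤n (An , t∈σ))

    successors-finite⇒converges : Infinite B × SuccessorsFinite → ConvergesAlong B εs ε
    successors-finite⇒converges (infinite , finite) = infinite , λ X C _ ε-open →
      let K = cover X
          (t , t∈ϱ , base≤t , t-successor) = successor-above (base∈ϱ K)
          (N , beyond) = finite t t∈ϱ t-successor
      in N , λ n N≤n Bn →
        let (s , s∈σ , t≤s) = ¬below⇒above (εs n) t∈ϱ (λ below → beyond n N≤n (Bn , below))
        in basicOpen-near K (εs n) ε-open (σ-downClosed (εs n) (≤-trans base≤t t≤s) s∈σ)
                          (λ t'∈ t'∈σ → Bn (top∈σ⇒A (tops-top K t'∈) t'∈σ))

lemma5p3 : ExcludedMiddle 0ℓ →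
    (T : OrderTree) (G : TGraph T) →
    let open OrderTree T
        open TreeNotions T
        open GraphNotions T G
    in Uniform → (ε : Ray) (εs : ℕ → Ray) →
       let ϱ  = σ ε
           ϱs = λ n → σ (εs n)
           A  = λ n → ProperSubset ϱ (ϱs n)
           B  = λ n → ¬ A n
       in (ConvergesAlong A εs ε ⇔
             (Infinite A × (∀ t → Top ϱ t → FinitelyMany (λ n → A n × ϱs n t))))
          × (ConvergesAlong B εs ε ⇔
             (Infinite B × (∀ t → ϱ t → IsSuccessor t →
                FinitelyMany (λ n → B n × (∀ s → ϱ s → ϱs n s → DownOpen t s)))))
lemma5p3 em T G U ε εs =
  mk⇔ (λ c → proj₁ c , converges⇒tops-finite c) tops-finite⇒converges ,
  mk⇔ (λ c → proj₁ c , converges⇒successors-finite c) successors-finite⇒converges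
  where open UniformGraph.Convergence em T G U ε εs
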